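{- For every $d\in\mathbb N$ and $q>0$ there is a constant $C=C(d,q)$ such that the following holds. Let $n\ge k$ be positive integers, let $\lambda\in\mathbb R[x_1,\dots,x_n]$ be a multilinear polynomial of degree at most $d$ all of whose coefficients have absolute value at most $q$, and let $\vec \sigma$ be uniformly distributed on $\operatorname{Slice}(n,k)$. Then \[\operatorname{Var}[\lambda(\vec \sigma)]\le C\, n^{2d-1}.\]
   Context: $\operatorname{Slice}(n,k)$ is the set of vectors in $\{0,1\}^n$ with exactly $k$ entries equal to $1$.
   Formalization: The coefficients of the polynomial λ and the bound q are rational numbers instead of real numbers. -}

module Defs where

open import Data.Bool using (Bool; true; false; if_then_else_)
open import Data.Nat as ℕ using (ℕ; zero; suc)
open import Data.Integer using (+_)
open import Data.List using (List; []; _∷_; _++_; map; filter; length; foldr)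
open import Data.Vec using (Vec; []; _∷_)
open import Data.Rational using (ℚ; 0ℚ; 1ℚ; _+_; _*_; _-_; _/_)
open import Relation.Binary.PropositionalEquality using (_≡_)
open import Data.Nat using (_≟_)

cube : (n : ℕ) → List (Vec Bool n)
cube zero = [] ∷ []
cube (suc n) = map (false ∷_) (cube n) ++ map (true ∷_) (cube n)

weight : ∀ {n} → Vec Bool n → ℕ
weight [] = 0
weight (false ∷ v) = weight v
weight (true ∷ v) = suc (weight v)

-- Slice(n,k): vectors of {0,1}^n with exactly k ones, as a list without repetition.
Slice : (n k : ℕ) → List (Vec Bool n)
Slice n k = filter (λ v → weight v ≟ k) (cube n)

-- A multilinear polynomial in x_1..x_n with rational coefficients, given by its
-- coefficient function: monomial ∏_{i ∈ S} x_i  ↦  coefficient, S ∈ {0,1}^n.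
Multilinear : ℕ → Set
Multilinear n = Vec Bool n → ℚ

bitℚ : Bool → ℚ
bitℚ true = 1ℚ
bitℚ false = 0ℚ

monomial : ∀ {n} → Vec Bool n → Vec Bool n → ℚ
monomial [] [] = 1ℚ
monomial (s ∷ S) (x ∷ xs) = (if s then bitℚ x else 1ℚ) * monomial S xs

sumℚ : List ℚ → ℚ
sumℚ = foldr _+_ 0ℚ

eval : ∀ {n} → Multilinear n → Vec Bool n → ℚ
eval {n} c x = sumℚ (map (λ S → c S * monomial S x) (cube n))

DegreeAtMost : ∀ {n} → ℕ → Multilinear n → Set
DegreeAtMost {n} d c = ∀ (S : Vec Bool n) → d ℕ.< weight S → c S ≡ 0ℚ

-- Average of a list of rationals (uniform distribution); 0 for the empty list.
average : List ℚ → ℚ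
average [] = 0ℚ
average (x ∷ xs) = sumℚ (x ∷ xs) * (+ 1 / suc (length xs))

variance : ∀ {A : Set} → List A → (A → ℚ) → ℚ
variance xs f =
  let μ = average (map f xs) in
  average (map (λ a → (f a - μ) * (f a - μ)) xs)

-- Write λ = Σ_S c_S x^S. For σ uniform on Slice(n,k) the moment E[σ^S] depends only on j = |S|:
-- it is R(j) = C(n-j,k-j)/C(n,k), so Var λ(σ) = Σ_{S,T} c_S c_T (R(|S ∪ T|) - R(|S|) R(|T|)).
-- The ratios (n-j) R(j+1) = (k-j) R(j) keep R close to geometric: with p = k/n the deviation
-- n (R(j) - p^j) grows by at most 2j per step, hence is at most j², and for disjoint S, T (where
-- |S ∪ T| = |S| + |T|) this gives n |R(|S ∪ T|) - R(|S|) R(|T|)| ≤ (|S| + |T|)² + |S|² + |T|².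
-- For overlapping S, T the covariance is at most 2. So each pair contributes at most
-- q² (2 + 6d²) n^|S ∩ T| to n·Var, and Σ_{|S|,|T| ≤ d} n^|S ∩ T| ≤ (4n)^2d, proved by induction on
-- the number m of coordinates with the bound (n + 3m)^(a+b) for budgets a, b.
module Submission where

open import Algebra.Bundles using (CommutativeMonoid; CommutativeRing; CommutativeSemiring)
open import Data.Bool using (Bool; true; false; if_then_else_; _∧_; _∨_)
open import Data.Integer as ℤ using (+_)
import Data.Integer.Properties as ℤₚ
open import Data.List using (List; []; _∷_; _++_; map; filter; foldr; length)
import Data.List.Properties as List
open import Data.Nat as ℕ using (ℕ; zero; suc; z≤n; s≤s; NonZero)
import Data.Nat.Properties as ℕₚ
open import Data.Nat.Combinatorics using (_C_; nCk+nC[k+1]≡[n+1]C[k+1]; nC1≡n)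
open import Data.Nat.Coprimality using (1-coprimeTo) renaming (sym to coprime-sym)
open import Data.Nat.Tactic.RingSolver using (solve-∀)
open import Data.Product using (Σ; _,_)
open import Data.Rational using (ℚ; 0ℚ; 1ℚ; _+_; _*_; _-_; -_; _≤_; _<_; _/_; ∣_∣; mkℚ; NonNegative; nonNegative)
open import Data.Rational.Properties
open import Data.Rational.Solver using (module +-*-Solver)
open import Data.Vec using (Vec; []; _∷_; zipWith; replicate)
open import Relation.Binary.PropositionalEquality using (_≡_; refl; sym; trans; cong; cong₂; subst; module ≡-Reasoning)
open import Relation.Nullary.Decidable using (does; yes; no)
open import Relation.Unary using (Decidable)

open import Algebra.Properties.Semiring.Exp (CommutativeRing.semiring +-*-commutativeRing) using (_^_; ^-homo-*)
open import Algebra.Properties.CommutativeSemigroup (CommutativeMonoid.commutativeSemigroup *-1-commutativeMonoid)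
  using (xy∙z≈y∙xz; xy∙z≈xz∙y; x∙yz≈y∙xz) renaming (interchange to *-interchange)
open +-*-Solver using (solve; _:+_; _:-_; :-_; _:*_; _:=_; con)

open import Defs

ι : ℕ → ℚ
ι n = + n / 1

private
  ι-mkℚ : ∀ n → ι n ≡ mkℚ (+ n) 0 (coprime-sym (1-coprimeTo n))
  ι-mkℚ n = ↥p/↧p≡p (mkℚ (+ n) 0 _)

-- 1ℚ + mkℚ (+ n) 0 _ normalises to (+ 1 ℤ.+ + n ℤ.* + 1) / 1.
ι-suc : ∀ n → ι (suc n) ≡ 1ℚ + ι n
ι-suc n = trans (cong (λ m → (+ 1 ℤ.+ m) / 1) (sym (ℤₚ.*-identityʳ (+ n)))) (cong (_+_ 1ℚ) (sym (ι-mkℚ n)))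

ι-+ : ∀ m n → ι (m ℕ.+ n) ≡ ι m + ι n
ι-+ zero    n = sym (+-identityˡ (ι n))
ι-+ (suc m) n = begin
  ι (suc (m ℕ.+ n))   ≡⟨ ι-suc (m ℕ.+ n) ⟩
  1ℚ + ι (m ℕ.+ n)    ≡⟨ cong (_+_ 1ℚ) (ι-+ m n) ⟩
  1ℚ + (ι m + ι n)    ≡⟨ sym (+-assoc 1ℚ (ι m) (ι n)) ⟩
  1ℚ + ι m + ι n      ≡⟨ cong (_+ ι n) (sym (ι-suc m)) ⟩
  ι (suc m) + ι n     ∎
  where open ≡-Reasoning

ι-* : ∀ m n → ι (m ℕ.* n) ≡ ι m * ι n
ι-* zero    n = sym (*-zeroˡ (ι n))
ι-* (suc m) n = begin
  ι (n ℕ.+ m ℕ.* n)    ≡⟨ ι-+ n (m ℕ.* n) ⟩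
  ι n + ι (m ℕ.* n)    ≡⟨ cong (_+_ (ι n)) (ι-* m n) ⟩
  ι n + ι m * ι n      ≡⟨ cong (_+ ι m * ι n) (sym (*-identityˡ (ι n))) ⟩
  1ℚ * ι n + ι m * ι n ≡⟨ sym (*-distribʳ-+ (ι n) 1ℚ (ι m)) ⟩
  (1ℚ + ι m) * ι n     ≡⟨ cong (_* ι n) (sym (ι-suc m)) ⟩
  ι (suc m) * ι n      ∎
  where open ≡-Reasoning

ι-nonNeg : ∀ n → 0ℚ ≤ ι n
ι-nonNeg n = nonNegative⁻¹ (ι n) {{normalize-nonNeg n 1}}

ι-mono-≤ : ∀ {m n} → m ℕ.≤ n → ι m ≤ ι n
ι-mono-≤ {m} {n} m≤n = begin
  ι m                  ≡⟨ sym (+-identityʳ (ι m)) ⟩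
  ι m + 0ℚ             ≤⟨ +-monoʳ-≤ (ι m) (ι-nonNeg (n ℕ.∸ m)) ⟩
  ι m + ι (n ℕ.∸ m)    ≡⟨ sym (ι-+ m (n ℕ.∸ m)) ⟩
  ι (m ℕ.+ (n ℕ.∸ m))  ≡⟨ cong ι (ℕₚ.m+[n∸m]≡n m≤n) ⟩
  ι n                  ∎
  where open ≤-Reasoning

ι-∸ : ∀ {m n} → n ℕ.≤ m → ι (m ℕ.∸ n) ≡ ι m - ι n
ι-∸ {m} {n} n≤m = begin
  ι (m ℕ.∸ n)                  ≡⟨ x≡x+y-y (ι (m ℕ.∸ n)) (ι n) ⟩
  ι (m ℕ.∸ n) + ι n - ι n      ≡⟨ cong (_- ι n) (sym (ι-+ (m ℕ.∸ n) n)) ⟩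
  ι (m ℕ.∸ n ℕ.+ n) - ι n      ≡⟨ cong (λ k → ι k - ι n) (ℕₚ.m∸n+n≡m n≤m) ⟩
  ι m - ι n                    ∎
  where
  open ≡-Reasoning
  x≡x+y-y : ∀ x y → x ≡ x + y - y
  x≡x+y-y = solve 2 (λ x y → x := x :+ y :- y) refl

ι-*-1/ : ∀ n .{{_ : NonZero n}} → ι n * (+ 1 / n) ≡ 1ℚ
ι-*-1/ (suc l) = trans (cong₂ _*_ (ι-mkℚ (suc l)) (↥p/↧p≡p (mkℚ (+ 1) l (1-coprimeTo (suc l)))))
                       (*-inverseʳ (mkℚ (+ suc l) 0 (coprime-sym (1-coprimeTo (suc l)))))

module ListSum {c ℓ} (R : CommutativeSemiring c ℓ) where

  private module R = CommutativeSemiring R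
  open R using (Carrier; _≈_; 0#)
  open import Algebra.Properties.CommutativeSemigroup R.+-commutativeSemigroup using (interchange)
  open import Relation.Binary.Reasoning.Setoid R.setoid

  ∑ : {I : Set} → List I → (I → Carrier) → Carrier
  ∑ xs f = foldr R._+_ 0# (map f xs)

  infix 5 ∑
  syntax ∑ xs (λ x → e) = ∑[ x ∈ xs ] e

  module _ {I : Set} where

    ∑-cong : ∀ (xs : List I) {f g : I → Carrier} → (∀ x → f x ≈ g x) → ∑ xs f ≈ ∑ xs g
    ∑-cong []       f≈g = R.refl
    ∑-cong (x ∷ xs) f≈g = R.+-cong (f≈g x) (∑-cong xs f≈g)

    ∑-++ : ∀ (xs ys : List I) f → ∑ (xs ++ ys) f ≈ ∑ xs f R.+ ∑ ys f
    ∑-++ []       ys f = R.sym (R.+-identityˡ (∑ ys f))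
    ∑-++ (x ∷ xs) ys f =
      R.trans (R.+-congˡ (∑-++ xs ys f)) (R.sym (R.+-assoc (f x) (∑ xs f) (∑ ys f)))

    ∑-map : ∀ {J : Set} (g : J → I) (xs : List J) f → ∑ (map g xs) f ≈ ∑[ x ∈ xs ] f (g x)
    ∑-map g []       f = R.refl
    ∑-map g (x ∷ xs) f = R.+-congˡ (∑-map g xs f)

    ∑-zero : ∀ (xs : List I) → ∑[ x ∈ xs ] 0# ≈ 0#
    ∑-zero []       = R.refl
    ∑-zero (x ∷ xs) = R.trans (R.+-congˡ (∑-zero xs)) (R.+-identityˡ 0#)

    ∑-distrib-+ : ∀ (xs : List I) f g → ∑[ x ∈ xs ] (f x R.+ g x) ≈ ∑ xs f R.+ ∑ xs g
    ∑-distrib-+ []       f g = R.sym (R.+-identityˡ 0#)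
    ∑-distrib-+ (x ∷ xs) f g =
      R.trans (R.+-congˡ (∑-distrib-+ xs f g)) (interchange (f x) (g x) (∑ xs f) (∑ xs g))

    *-distribˡ-∑ : ∀ a (xs : List I) f → a R.* ∑ xs f ≈ ∑[ x ∈ xs ] a R.* f x
    *-distribˡ-∑ a []       f = R.zeroʳ a
    *-distribˡ-∑ a (x ∷ xs) f = R.trans (R.distribˡ a (f x) (∑ xs f)) (R.+-congˡ (*-distribˡ-∑ a xs f))

    *-distribʳ-∑ : ∀ a (xs : List I) f → ∑ xs f R.* a ≈ ∑[ x ∈ xs ] f x R.* a
    *-distribʳ-∑ a xs f = begin
      ∑ xs f R.* a           ≈⟨ R.*-comm (∑ xs f) a ⟩
      a R.* ∑ xs f           ≈⟨ *-distribˡ-∑ a xs f ⟩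
      ∑[ x ∈ xs ] a R.* f x  ≈⟨ ∑-cong xs (λ x → R.*-comm a (f x)) ⟩
      ∑[ x ∈ xs ] f x R.* a  ∎

  module _ {I J : Set} where

    ∑-comm : ∀ (xs : List I) (ys : List J) (f : I → J → Carrier) →
             ∑[ x ∈ xs ] ∑[ y ∈ ys ] f x y ≈ ∑[ y ∈ ys ] ∑[ x ∈ xs ] f x y
    ∑-comm []       ys f = R.sym (∑-zero ys)
    ∑-comm (x ∷ xs) ys f =
      R.trans (R.+-congˡ (∑-comm xs ys f)) (R.sym (∑-distrib-+ ys (f x) (λ y → ∑[ x ∈ xs ] f x y)))

    ∑-*-∑ : ∀ (xs : List I) (ys : List J) (f : I → Carrier) (g : J → Carrier) →
            ∑ xs f R.* ∑ ys g ≈ ∑[ x ∈ xs ] ∑[ y ∈ ys ] f x R.* g y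
    ∑-*-∑ xs ys f g = R.trans (*-distribʳ-∑ (∑ ys g) xs f) (∑-cong xs (λ x → *-distribˡ-∑ (f x) ys g))

module ℕΣ = ListSum ℕₚ.+-*-commutativeSemiring
module ℚΣ = ListSum (CommutativeRing.commutativeSemiring +-*-commutativeRing)

_∪_ _∩_ : ∀ {n} → Vec Bool n → Vec Bool n → Vec Bool n
S ∪ T = zipWith _∨_ S T
S ∩ T = zipWith _∧_ S T

∅ : ∀ n → Vec Bool n
∅ n = replicate n false

weight-∅ : ∀ n → weight (∅ n) ≡ 0
weight-∅ zero    = refl
weight-∅ (suc n) = weight-∅ n

weight≤length : ∀ {n} (S : Vec Bool n) → weight S ℕ.≤ n
weight≤length []          = z≤n
weight≤length (false ∷ S) = ℕₚ.m≤n⇒m≤1+n (weight≤length S)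
weight≤length (true ∷ S)  = s≤s (weight≤length S)

weight-∪+weight-∩ : ∀ {n} (S T : Vec Bool n) → weight (S ∪ T) ℕ.+ weight (S ∩ T) ≡ weight S ℕ.+ weight T
weight-∪+weight-∩ []          []          = refl
weight-∪+weight-∩ (false ∷ S) (false ∷ T) = weight-∪+weight-∩ S T
weight-∪+weight-∩ (true ∷ S)  (false ∷ T) = cong suc (weight-∪+weight-∩ S T)
weight-∪+weight-∩ (false ∷ S) (true ∷ T)  =
  trans (cong suc (weight-∪+weight-∩ S T)) (sym (ℕₚ.+-suc (weight S) (weight T)))
weight-∪+weight-∩ (true ∷ S)  (true ∷ T)  = cong suc (begin
  weight (S ∪ T) ℕ.+ suc (weight (S ∩ T))  ≡⟨ ℕₚ.+-suc (weight (S ∪ T)) (weight (S ∩ T)) ⟩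
  suc (weight (S ∪ T) ℕ.+ weight (S ∩ T))  ≡⟨ cong suc (weight-∪+weight-∩ S T) ⟩
  suc (weight S ℕ.+ weight T)              ≡⟨ sym (ℕₚ.+-suc (weight S) (weight T)) ⟩
  weight S ℕ.+ suc (weight T)              ∎)
  where open ≡-Reasoning

-- The indicator of weight S ≤ a, by recursion on S so that it unfolds along cube.
atMost : ∀ {m} → ℕ → Vec Bool m → ℕ
atMost a       []          = 1
atMost a       (false ∷ S) = atMost a S
atMost zero    (true ∷ S)  = 0
atMost (suc a) (true ∷ S)  = atMost a S

atMost-≤ : ∀ {m a} (S : Vec Bool m) → weight S ℕ.≤ a → atMost a S ≡ 1
atMost-≤                []          _           = refl
atMost-≤                (false ∷ S) |S|≤a       = atMost-≤ S |S|≤a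
atMost-≤ {a = suc a}    (true ∷ S)  (s≤s |S|≤a) = atMost-≤ S |S|≤a

^-distribʳ-* : ∀ m n e → (m ℕ.* n) ℕ.^ e ≡ m ℕ.^ e ℕ.* n ℕ.^ e
^-distribʳ-* m n zero    = refl
^-distribʳ-* m n (suc e) = trans (cong (m ℕ.* n ℕ.*_) (^-distribʳ-* m n e)) (shuffle m n (m ℕ.^ e) (n ℕ.^ e))
  where
  shuffle : ∀ a b c d → a ℕ.* b ℕ.* (c ℕ.* d) ≡ a ℕ.* c ℕ.* (b ℕ.* d)
  shuffle = solve-∀

Y^[1+s]+Y^s≤[3+Y]^[1+s] : ∀ Y s → Y ℕ.^ suc s ℕ.+ Y ℕ.^ s ℕ.≤ (3 ℕ.+ Y) ℕ.^ suc s
Y^[1+s]+Y^s≤[3+Y]^[1+s] Y s = begin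
  Y ℕ.* Y ℕ.^ s ℕ.+ Y ℕ.^ s    ≡⟨ factor Y (Y ℕ.^ s) ⟩
  (1 ℕ.+ Y) ℕ.* Y ℕ.^ s        ≤⟨ ℕₚ.*-mono-≤ (ℕₚ.+-monoˡ-≤ Y (s≤s (z≤n {2}))) (ℕₚ.^-monoˡ-≤ s (ℕₚ.m≤n+m Y 3)) ⟩
  (3 ℕ.+ Y) ℕ.* (3 ℕ.+ Y) ℕ.^ s ∎
  where
  open ℕₚ.≤-Reasoning
  factor : ∀ y z → y ℕ.* z ℕ.+ z ≡ (1 ℕ.+ y) ℕ.* z
  factor = solve-∀

Y^[2+s]+2Y^[1+s]+NY^s≤[3+Y]^[2+s] : ∀ {N Y} s → N ℕ.≤ Y →
  Y ℕ.^ (2 ℕ.+ s) ℕ.+ Y ℕ.^ (1 ℕ.+ s) ℕ.+ (Y ℕ.^ (1 ℕ.+ s) ℕ.+ N ℕ.* Y ℕ.^ s) ℕ.≤ (3 ℕ.+ Y) ℕ.^ (2 ℕ.+ s)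
Y^[2+s]+2Y^[1+s]+NY^s≤[3+Y]^[2+s] {N} {Y} s N≤Y = begin
  Y ℕ.* (Y ℕ.* Y ℕ.^ s) ℕ.+ Y ℕ.* Y ℕ.^ s ℕ.+ (Y ℕ.* Y ℕ.^ s ℕ.+ N ℕ.* Y ℕ.^ s)
    ≤⟨ ℕₚ.+-monoʳ-≤ (Y ℕ.* (Y ℕ.* Y ℕ.^ s) ℕ.+ Y ℕ.* Y ℕ.^ s) (ℕₚ.+-monoʳ-≤ (Y ℕ.* Y ℕ.^ s) (ℕₚ.*-monoˡ-≤ (Y ℕ.^ s) N≤Y)) ⟩
  Y ℕ.* (Y ℕ.* Y ℕ.^ s) ℕ.+ Y ℕ.* Y ℕ.^ s ℕ.+ (Y ℕ.* Y ℕ.^ s ℕ.+ Y ℕ.* Y ℕ.^ s)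
    ≡⟨ collect Y (Y ℕ.^ s) ⟩
  (Y ℕ.* Y ℕ.+ 3 ℕ.* Y) ℕ.* Y ℕ.^ s
    ≤⟨ ℕₚ.*-mono-≤ (ℕₚ.m≤m+n (Y ℕ.* Y ℕ.+ 3 ℕ.* Y) (3 ℕ.* Y ℕ.+ 9)) (ℕₚ.^-monoˡ-≤ s (ℕₚ.m≤n+m Y 3)) ⟩
  (Y ℕ.* Y ℕ.+ 3 ℕ.* Y ℕ.+ (3 ℕ.* Y ℕ.+ 9)) ℕ.* (3 ℕ.+ Y) ℕ.^ s
    ≡⟨ square Y ((3 ℕ.+ Y) ℕ.^ s) ⟩
  (3 ℕ.+ Y) ℕ.* ((3 ℕ.+ Y) ℕ.* (3 ℕ.+ Y) ℕ.^ s) ∎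
  where
  open ℕₚ.≤-Reasoning
  collect : ∀ y z → y ℕ.* (y ℕ.* z) ℕ.+ y ℕ.* z ℕ.+ (y ℕ.* z ℕ.+ y ℕ.* z) ≡ (y ℕ.* y ℕ.+ 3 ℕ.* y) ℕ.* z
  collect = solve-∀
  square : ∀ y z → (y ℕ.* y ℕ.+ 3 ℕ.* y ℕ.+ (3 ℕ.* y ℕ.+ 9)) ℕ.* z ≡ (3 ℕ.+ y) ℕ.* ((3 ℕ.+ y) ℕ.* z)
  square = solve-∀

module OverlapCount (N : ℕ) .{{_ : NonZero N}} where

  open ℕΣ
  open ℕₚ.≤-Reasoning

  pairWeight : ∀ {m} → ℕ → ℕ → Vec Bool m → Vec Bool m → ℕ
  pairWeight a b S T = atMost a S ℕ.* atMost b T ℕ.* N ℕ.^ weight (S ∩ T)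

  overlapSum : ℕ → ℕ → ℕ → ℕ
  overlapSum m a b = ∑[ S ∈ cube m ] ∑[ T ∈ cube m ] pairWeight a b S T

  ∑-cube-suc : ∀ m (h : Vec Bool (suc m) → ℕ) →
               ∑ (cube (suc m)) h ≡ (∑[ S ∈ cube m ] h (false ∷ S)) ℕ.+ (∑[ S ∈ cube m ] h (true ∷ S))
  ∑-cube-suc m h = trans (∑-++ (map (false ∷_) (cube m)) (map (true ∷_) (cube m)) h)
                         (cong₂ ℕ._+_ (∑-map (false ∷_) (cube m) h) (∑-map (true ∷_) (cube m) h))

  corner : Bool → Bool → ℕ → ℕ → ℕ → ℕ
  corner s t m a b = ∑[ S ∈ cube m ] ∑[ T ∈ cube m ] pairWeight a b (s ∷ S) (t ∷ T)

  overlapSum-suc : ∀ m a b → overlapSum (suc m) a b ≡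
    overlapSum m a b ℕ.+ corner false true m a b ℕ.+ (corner true false m a b ℕ.+ corner true true m a b)
  overlapSum-suc m a b =
    trans (∑-cube-suc m (λ S → ∑[ T ∈ cube (suc m) ] pairWeight a b S T)) (cong₂ ℕ._+_ (split false) (split true))
    where
    split : ∀ s → ∑[ S ∈ cube m ] ∑[ T ∈ cube (suc m) ] pairWeight a b (s ∷ S) T ≡
                  corner s false m a b ℕ.+ corner s true m a b
    split s = trans (∑-cong (cube m) (λ S → ∑-cube-suc m (pairWeight a b (s ∷ S))))
                    (∑-distrib-+ (cube m) _ _)

  corner-vanishes : ∀ s t m a b → (∀ (S T : Vec Bool m) → pairWeight a b (s ∷ S) (t ∷ T) ≡ 0) →
                    corner s t m a b ≡ 0
  corner-vanishes s t m a b zero-weight =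
    trans (∑-cong (cube m) (λ S → trans (∑-cong (cube m) (zero-weight S)) (∑-zero (cube m)))) (∑-zero (cube m))

  zero-budget : ∀ x y → x ℕ.* 0 ℕ.* y ≡ 0
  zero-budget x y = cong (ℕ._* y) (ℕₚ.*-zeroʳ x)

  corner-true-true : ∀ m a b → corner true true m (suc a) (suc b) ≡ N ℕ.* overlapSum m a b
  corner-true-true m a b = sym (trans (*-distribˡ-∑ N (cube m) _)
    (∑-cong (cube m) (λ S → trans (*-distribˡ-∑ N (cube m) _)
      (∑-cong (cube m) (λ T → shuffle N (atMost a S) (atMost b T) (N ℕ.^ weight (S ∩ T)))))))
    where
    shuffle : ∀ n x y z → n ℕ.* (x ℕ.* y ℕ.* z) ≡ x ℕ.* y ℕ.* (n ℕ.* z)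
    shuffle = solve-∀

  overlapSum-bound : ∀ m a b → overlapSum m a b ℕ.≤ (N ℕ.+ 3 ℕ.* m) ℕ.^ (a ℕ.+ b)
  overlapSum-bound zero    a b = begin
    1                        ≤⟨ ℕₚ.m^n>0 N (a ℕ.+ b) ⟩
    N ℕ.^ (a ℕ.+ b)          ≤⟨ ℕₚ.^-monoˡ-≤ (a ℕ.+ b) (ℕₚ.m≤m+n N 0) ⟩
    (N ℕ.+ 0) ℕ.^ (a ℕ.+ b)  ∎
  overlapSum-bound (suc m) a b = begin
    overlapSum (suc m) a b                ≡⟨ overlapSum-suc m a b ⟩
    overlapSum m a b ℕ.+ corner false true m a b ℕ.+ (corner true false m a b ℕ.+ corner true true m a b)
                                          ≤⟨ step a b ⟩
    (3 ℕ.+ Y) ℕ.^ (a ℕ.+ b)               ≡⟨ cong (ℕ._^ (a ℕ.+ b)) (shift N m) ⟩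
    (N ℕ.+ 3 ℕ.* suc m) ℕ.^ (a ℕ.+ b)     ∎
    where
    Y = N ℕ.+ 3 ℕ.* m
    shift : ∀ n m → 3 ℕ.+ (n ℕ.+ 3 ℕ.* m) ≡ n ℕ.+ 3 ℕ.* suc m
    shift = solve-∀
    IH = overlapSum-bound m
    step : ∀ a b → overlapSum m a b ℕ.+ corner false true m a b ℕ.+ (corner true false m a b ℕ.+ corner true true m a b)
                   ℕ.≤ (3 ℕ.+ Y) ℕ.^ (a ℕ.+ b)
    step zero zero = begin
      overlapSum m 0 0 ℕ.+ corner false true m 0 0 ℕ.+ (corner true false m 0 0 ℕ.+ corner true true m 0 0)
        ≡⟨ cong₂ (λ x y → overlapSum m 0 0 ℕ.+ x ℕ.+ y) (corner-vanishes false true m 0 0 (λ S T → zero-budget (atMost 0 S) _))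
                 (cong₂ ℕ._+_ (corner-vanishes true false m 0 0 (λ _ _ → refl)) (corner-vanishes true true m 0 0 (λ _ _ → refl))) ⟩
      overlapSum m 0 0 ℕ.+ 0 ℕ.+ 0       ≡⟨ trans (ℕₚ.+-identityʳ _) (ℕₚ.+-identityʳ (overlapSum m 0 0)) ⟩
      overlapSum m 0 0                   ≤⟨ IH 0 0 ⟩
      1                                  ∎
    step (suc a) zero = begin
      overlapSum m (suc a) 0 ℕ.+ corner false true m (suc a) 0 ℕ.+ (overlapSum m a 0 ℕ.+ corner true true m (suc a) 0)
        ≡⟨ cong₂ (λ x y → overlapSum m (suc a) 0 ℕ.+ x ℕ.+ (overlapSum m a 0 ℕ.+ y))
                 (corner-vanishes false true m (suc a) 0 (λ S T → zero-budget (atMost (suc a) S) _))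
                 (corner-vanishes true true m (suc a) 0 (λ S T → zero-budget (atMost a S) _)) ⟩
      overlapSum m (suc a) 0 ℕ.+ 0 ℕ.+ (overlapSum m a 0 ℕ.+ 0)
        ≡⟨ cong₂ ℕ._+_ (ℕₚ.+-identityʳ (overlapSum m (suc a) 0)) (ℕₚ.+-identityʳ (overlapSum m a 0)) ⟩
      overlapSum m (suc a) 0 ℕ.+ overlapSum m a 0
        ≤⟨ ℕₚ.+-mono-≤ (IH (suc a) 0) (IH a 0) ⟩
      Y ℕ.^ suc (a ℕ.+ 0) ℕ.+ Y ℕ.^ (a ℕ.+ 0)
        ≤⟨ Y^[1+s]+Y^s≤[3+Y]^[1+s] Y (a ℕ.+ 0) ⟩
      (3 ℕ.+ Y) ℕ.^ suc (a ℕ.+ 0) ∎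
    step zero (suc b) = begin
      overlapSum m 0 (suc b) ℕ.+ overlapSum m 0 b ℕ.+ (corner true false m 0 (suc b) ℕ.+ corner true true m 0 (suc b))
        ≡⟨ cong (overlapSum m 0 (suc b) ℕ.+ overlapSum m 0 b ℕ.+_)
                (cong₂ ℕ._+_ (corner-vanishes true false m 0 (suc b) (λ _ _ → refl))
                              (corner-vanishes true true m 0 (suc b) (λ _ _ → refl))) ⟩
      overlapSum m 0 (suc b) ℕ.+ overlapSum m 0 b ℕ.+ 0
        ≡⟨ ℕₚ.+-identityʳ (overlapSum m 0 (suc b) ℕ.+ overlapSum m 0 b) ⟩
      overlapSum m 0 (suc b) ℕ.+ overlapSum m 0 b
        ≤⟨ ℕₚ.+-mono-≤ (IH 0 (suc b)) (IH 0 b) ⟩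
      Y ℕ.^ suc b ℕ.+ Y ℕ.^ b
        ≤⟨ Y^[1+s]+Y^s≤[3+Y]^[1+s] Y b ⟩
      (3 ℕ.+ Y) ℕ.^ suc b ∎
    step (suc a) (suc b) = begin
      overlapSum m (suc a) (suc b) ℕ.+ overlapSum m (suc a) b ℕ.+ (overlapSum m a (suc b) ℕ.+ corner true true m (suc a) (suc b))
        ≡⟨ cong (λ x → overlapSum m (suc a) (suc b) ℕ.+ overlapSum m (suc a) b ℕ.+ (overlapSum m a (suc b) ℕ.+ x))
                (corner-true-true m a b) ⟩
      overlapSum m (suc a) (suc b) ℕ.+ overlapSum m (suc a) b ℕ.+ (overlapSum m a (suc b) ℕ.+ N ℕ.* overlapSum m a b)
        ≤⟨ ℕₚ.+-mono-≤ (ℕₚ.+-mono-≤ (IH (suc a) (suc b)) (IH (suc a) b))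
                       (ℕₚ.+-mono-≤ (IH a (suc b)) (ℕₚ.*-monoʳ-≤ N (IH a b))) ⟩
      Y ℕ.^ suc (a ℕ.+ suc b) ℕ.+ Y ℕ.^ suc (a ℕ.+ b) ℕ.+ (Y ℕ.^ (a ℕ.+ suc b) ℕ.+ N ℕ.* Y ℕ.^ (a ℕ.+ b))
        ≡⟨ cong (λ t → Y ℕ.^ suc t ℕ.+ Y ℕ.^ suc (a ℕ.+ b) ℕ.+ (Y ℕ.^ t ℕ.+ N ℕ.* Y ℕ.^ (a ℕ.+ b))) (ℕₚ.+-suc a b) ⟩
      Y ℕ.^ (2 ℕ.+ (a ℕ.+ b)) ℕ.+ Y ℕ.^ (1 ℕ.+ (a ℕ.+ b)) ℕ.+ (Y ℕ.^ (1 ℕ.+ (a ℕ.+ b)) ℕ.+ N ℕ.* Y ℕ.^ (a ℕ.+ b))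
        ≤⟨ Y^[2+s]+2Y^[1+s]+NY^s≤[3+Y]^[2+s] (a ℕ.+ b) (ℕₚ.m≤m+n N (3 ℕ.* m)) ⟩
      (3 ℕ.+ Y) ℕ.^ (2 ℕ.+ (a ℕ.+ b))
        ≡⟨ cong (λ t → (3 ℕ.+ Y) ℕ.^ suc t) (sym (ℕₚ.+-suc a b)) ⟩
      (3 ℕ.+ Y) ℕ.^ (suc a ℕ.+ suc b) ∎

  overlapSum-diagonal : ∀ d → overlapSum N d d ℕ.≤ 4 ℕ.^ (2 ℕ.* d) ℕ.* N ℕ.^ (2 ℕ.* d)
  overlapSum-diagonal d = begin
    overlapSum N d d                        ≤⟨ overlapSum-bound N d d ⟩
    (N ℕ.+ 3 ℕ.* N) ℕ.^ (d ℕ.+ d)           ≡⟨ cong₂ ℕ._^_ (four N) (double d) ⟩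
    (4 ℕ.* N) ℕ.^ (2 ℕ.* d)                 ≡⟨ ^-distribʳ-* 4 N (2 ℕ.* d) ⟩
    4 ℕ.^ (2 ℕ.* d) ℕ.* N ℕ.^ (2 ℕ.* d)     ∎
    where
    four : ∀ n → n ℕ.+ 3 ℕ.* n ≡ 4 ℕ.* n
    four = solve-∀
    double : ∀ d → d ℕ.+ d ≡ 2 ℕ.* d
    double = solve-∀

open ℚΣ

∑[f-g]≡∑f-∑g : ∀ {I : Set} (xs : List I) f g → ∑[ x ∈ xs ] (f x - g x) ≡ ∑ xs f - ∑ xs g
∑[f-g]≡∑f-∑g []       f g = refl
∑[f-g]≡∑f-∑g (x ∷ xs) f g = trans (cong (_+_ (f x - g x)) (∑[f-g]≡∑f-∑g xs f g)) (regroup (f x) (g x) (∑ xs f) (∑ xs g))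
  where
  regroup : ∀ a b c d → a - b + (c - d) ≡ a + c - (b + d)
  regroup = solve 4 (λ a b c d → a :- b :+ (c :- d) := a :+ c :- (b :+ d)) refl

∑-const : ∀ {I : Set} (xs : List I) a → ∑[ x ∈ xs ] a ≡ ι (length xs) * a
∑-const []       a = sym (*-zeroˡ a)
∑-const (x ∷ xs) a = begin
  a + (∑[ x ∈ xs ] a)        ≡⟨ cong (_+_ a) (∑-const xs a) ⟩
  a + ι (length xs) * a      ≡⟨ factor a (ι (length xs)) ⟩
  (1ℚ + ι (length xs)) * a   ≡⟨ cong (_* a) (sym (ι-suc (length xs))) ⟩
  ι (suc (length xs)) * a    ∎
  where
  open ≡-Reasoning
  factor : ∀ a l → a + l * a ≡ (1ℚ + l) * a
  factor = solve 2 (λ a l → a :+ l :* a := (con 1ℚ :+ l) :* a) refl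

ι-∑ : ∀ {I : Set} (xs : List I) f → ι (ℕΣ.∑ xs f) ≡ ∑[ x ∈ xs ] ι (f x)
ι-∑ []       f = refl
ι-∑ (x ∷ xs) f = trans (ι-+ (f x) (ℕΣ.∑ xs f)) (cong (_+_ (ι (f x))) (ι-∑ xs f))

∑-mono-≤ : ∀ {I : Set} (xs : List I) {f g : I → ℚ} → (∀ x → f x ≤ g x) → ∑ xs f ≤ ∑ xs g
∑-mono-≤ []       f≤g = ≤-refl
∑-mono-≤ (x ∷ xs) f≤g = +-mono-≤ (f≤g x) (∑-mono-≤ xs f≤g)

p≤∣p∣ : ∀ p → p ≤ ∣ p ∣
p≤∣p∣ p with 0ℚ ≤? p
... | yes 0≤p = ≤-reflexive (sym (0≤p⇒∣p∣≡p 0≤p))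
... | no  0≰p = ≤-trans (<⇒≤ (≰⇒> 0≰p)) (0≤∣p∣ p)

*-mono-≤-nonNeg : ∀ {a b c d} → 0ℚ ≤ a → 0ℚ ≤ c → a ≤ b → c ≤ d → a * c ≤ b * d
*-mono-≤-nonNeg {a} {b} {c} {d} 0≤a 0≤c a≤b c≤d =
  ≤-trans (*-monoʳ-≤-nonNeg c {{nonNegative 0≤c}} a≤b) (*-monoˡ-≤-nonNeg b {{nonNegative (≤-trans 0≤a a≤b)}} c≤d)

*-nonNeg : ∀ {a b} → 0ℚ ≤ a → 0ℚ ≤ b → 0ℚ ≤ a * b
*-nonNeg {a} {b} 0≤a 0≤b = *-mono-≤-nonNeg ≤-refl ≤-refl 0≤a 0≤b

∣*∣-mono-≤ : ∀ {a b u v} → ∣ a ∣ ≤ u → ∣ b ∣ ≤ v → ∣ a * b ∣ ≤ u * v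
∣*∣-mono-≤ {a} {b} ∣a∣≤u ∣b∣≤v =
  subst (_≤ _) (sym (∣p*q∣≡∣p∣*∣q∣ a b)) (*-mono-≤-nonNeg (0≤∣p∣ a) (0≤∣p∣ b) ∣a∣≤u ∣b∣≤v)

∣p-q∣≤2 : ∀ {a b} → ∣ a ∣ ≤ 1ℚ → ∣ b ∣ ≤ 1ℚ → ∣ a - b ∣ ≤ ι 2
∣p-q∣≤2 {a} {b} ∣a∣≤1 ∣b∣≤1 = ≤-trans (∣p-q∣≤∣p∣+∣q∣ a b) (+-mono-≤ ∣a∣≤1 ∣b∣≤1)

∣ι∣≡ι : ∀ n → ∣ ι n ∣ ≡ ι n
∣ι∣≡ι n = 0≤p⇒∣p∣≡p (ι-nonNeg n)

0≤p≤1⇒∣p∣≤1 : ∀ {a} → 0ℚ ≤ a → a ≤ 1ℚ → ∣ a ∣ ≤ 1ℚ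
0≤p≤1⇒∣p∣≤1 0≤a a≤1 = subst (_≤ 1ℚ) (sym (0≤p⇒∣p∣≡p 0≤a)) a≤1

module Uniform {A : Set} (x : A) (xs : List A) where

  Ω : List A
  Ω = x ∷ xs

  𝔼 : (A → ℚ) → ℚ
  𝔼 f = average (map f Ω)

  w : ℚ
  w = + 1 / suc (length xs)

  𝔼-≡-∑ : ∀ f → 𝔼 f ≡ ∑ Ω f * w
  𝔼-≡-∑ f = cong (λ l → ∑ Ω f * (+ 1 / suc l)) (List.length-map f xs)

  𝔼-cong : ∀ {f g} → (∀ σ → f σ ≡ g σ) → 𝔼 f ≡ 𝔼 g
  𝔼-cong f≗g = cong average (List.map-cong f≗g Ω)

  𝔼-const : ∀ a → 𝔼 (λ _ → a) ≡ a
  𝔼-const a = begin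
    𝔼 (λ _ → a)                              ≡⟨ 𝔼-≡-∑ (λ _ → a) ⟩
    (∑[ σ ∈ Ω ] a) * w                       ≡⟨ cong (_* w) (∑-const Ω a) ⟩
    ι (length Ω) * a * w                     ≡⟨ xy∙z≈y∙xz (ι (length Ω)) a w ⟩
    a * (ι (length Ω) * w)                   ≡⟨ cong (_*_ a) (ι-*-1/ (suc (length xs))) ⟩
    a * 1ℚ                                   ≡⟨ *-identityʳ a ⟩
    a                                        ∎
    where open ≡-Reasoning

  𝔼-distrib-+ : ∀ f g → 𝔼 (λ σ → f σ + g σ) ≡ 𝔼 f + 𝔼 g
  𝔼-distrib-+ f g = begin
    𝔼 (λ σ → f σ + g σ)        ≡⟨ 𝔼-≡-∑ (λ σ → f σ + g σ) ⟩
    (∑[ σ ∈ Ω ] f σ + g σ) * w ≡⟨ cong (_* w) (∑-distrib-+ Ω f g) ⟩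
    (∑ Ω f + ∑ Ω g) * w        ≡⟨ *-distribʳ-+ w (∑ Ω f) (∑ Ω g) ⟩
    ∑ Ω f * w + ∑ Ω g * w      ≡⟨ sym (cong₂ _+_ (𝔼-≡-∑ f) (𝔼-≡-∑ g)) ⟩
    𝔼 f + 𝔼 g                  ∎
    where open ≡-Reasoning

  𝔼-*ˡ : ∀ a f → 𝔼 (λ σ → a * f σ) ≡ a * 𝔼 f
  𝔼-*ˡ a f = begin
    𝔼 (λ σ → a * f σ)          ≡⟨ 𝔼-≡-∑ (λ σ → a * f σ) ⟩
    (∑[ σ ∈ Ω ] a * f σ) * w   ≡⟨ cong (_* w) (sym (*-distribˡ-∑ a Ω f)) ⟩
    a * ∑ Ω f * w              ≡⟨ *-assoc a (∑ Ω f) w ⟩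
    a * (∑ Ω f * w)            ≡⟨ cong (_*_ a) (sym (𝔼-≡-∑ f)) ⟩
    a * 𝔼 f                    ∎
    where open ≡-Reasoning

  𝔼-∑ : ∀ {I : Set} (is : List I) (h : I → A → ℚ) → 𝔼 (λ σ → ∑[ i ∈ is ] h i σ) ≡ ∑[ i ∈ is ] 𝔼 (h i)
  𝔼-∑ is h = begin
    𝔼 (λ σ → ∑[ i ∈ is ] h i σ)             ≡⟨ 𝔼-≡-∑ (λ σ → ∑[ i ∈ is ] h i σ) ⟩
    (∑[ σ ∈ Ω ] ∑[ i ∈ is ] h i σ) * w      ≡⟨ cong (_* w) (∑-comm Ω is (λ σ i → h i σ)) ⟩
    (∑[ i ∈ is ] ∑[ σ ∈ Ω ] h i σ) * w      ≡⟨ *-distribʳ-∑ w is (λ i → ∑ Ω (h i)) ⟩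
    ∑[ i ∈ is ] ∑ Ω (h i) * w               ≡⟨ ∑-cong is (λ i → sym (𝔼-≡-∑ (h i))) ⟩
    ∑[ i ∈ is ] 𝔼 (h i)                     ∎
    where open ≡-Reasoning

  variance-≡ : ∀ f → variance Ω f ≡ 𝔼 (λ σ → f σ * f σ) - 𝔼 f * 𝔼 f
  variance-≡ f = begin
    𝔼 (λ σ → (f σ - μ) * (f σ - μ))                         ≡⟨ 𝔼-cong (λ σ → expand (f σ) μ) ⟩
    𝔼 (λ σ → f σ * f σ + - (μ + μ) * f σ + μ * μ)           ≡⟨ 𝔼-distrib-+ (λ σ → f σ * f σ + - (μ + μ) * f σ) (λ _ → μ * μ) ⟩
    𝔼 (λ σ → f σ * f σ + - (μ + μ) * f σ) + 𝔼 (λ _ → μ * μ) ≡⟨ cong₂ _+_ (𝔼-distrib-+ (λ σ → f σ * f σ) (λ σ → - (μ + μ) * f σ)) (𝔼-const (μ * μ)) ⟩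
    𝔼 (λ σ → f σ * f σ) + 𝔼 (λ σ → - (μ + μ) * f σ) + μ * μ ≡⟨ cong (λ z → 𝔼 (λ σ → f σ * f σ) + z + μ * μ) (𝔼-*ˡ (- (μ + μ)) f) ⟩
    𝔼 (λ σ → f σ * f σ) + - (μ + μ) * μ + μ * μ             ≡⟨ collapse (𝔼 (λ σ → f σ * f σ)) μ ⟩
    𝔼 (λ σ → f σ * f σ) - μ * μ                             ∎
    where
    open ≡-Reasoning
    μ = 𝔼 f
    expand : ∀ y m → (y - m) * (y - m) ≡ y * y + - (m + m) * y + m * m
    expand = solve 2 (λ y m → (y :- m) :* (y :- m) := y :* y :+ (:- (m :+ m)) :* y :+ m :* m) refl
    collapse : ∀ s m → s + - (m + m) * m + m * m ≡ s - m * m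
    collapse = solve 2 (λ s m → s :+ (:- (m :+ m)) :* m :+ m :* m := s :- m :* m) refl

  variance-∑ : ∀ {I : Set} (is : List I) (a : I → ℚ) (f : I → A → ℚ) →
    variance Ω (λ σ → ∑[ i ∈ is ] a i * f i σ) ≡
    ∑[ i ∈ is ] ∑[ j ∈ is ] a i * a j * (𝔼 (λ σ → f i σ * f j σ) - 𝔼 (f i) * 𝔼 (f j))
  variance-∑ {I} is a f = begin
    variance Ω F                                                  ≡⟨ variance-≡ F ⟩
    𝔼 (λ σ → F σ * F σ) - 𝔼 F * 𝔼 F                               ≡⟨ cong₂ _-_ second-moment first-moment² ⟩
    (∑[ i ∈ is ] ∑[ j ∈ is ] a i * a j * M i j) - (∑[ i ∈ is ] ∑[ j ∈ is ] a i * a j * (μ i * μ j))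
      ≡⟨ sym (∑[f-g]≡∑f-∑g is _ _) ⟩
    ∑[ i ∈ is ] ((∑[ j ∈ is ] a i * a j * M i j) - (∑[ j ∈ is ] a i * a j * (μ i * μ j)))
      ≡⟨ ∑-cong is (λ i → sym (∑[f-g]≡∑f-∑g is _ _)) ⟩
    ∑[ i ∈ is ] ∑[ j ∈ is ] (a i * a j * M i j - a i * a j * (μ i * μ j))
      ≡⟨ ∑-cong is (λ i → ∑-cong is (λ j → factor (a i * a j) (M i j) (μ i * μ j))) ⟩
    ∑[ i ∈ is ] ∑[ j ∈ is ] a i * a j * (M i j - μ i * μ j)         ∎
    where
    open ≡-Reasoning
    F : A → ℚ
    F σ = ∑[ i ∈ is ] a i * f i σ
    M : I → I → ℚ
    M i j = 𝔼 (λ σ → f i σ * f j σ)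
    μ : I → ℚ
    μ i = 𝔼 (f i)
    factor : ∀ c x y → c * x - c * y ≡ c * (x - y)
    factor = solve 3 (λ c x y → c :* x :- c :* y := c :* (x :- y)) refl
    second-moment : 𝔼 (λ σ → F σ * F σ) ≡ ∑[ i ∈ is ] ∑[ j ∈ is ] a i * a j * M i j
    second-moment = begin
      𝔼 (λ σ → F σ * F σ)
        ≡⟨ 𝔼-cong (λ σ → trans (∑-*-∑ is is _ _) (∑-cong is (λ i → ∑-cong is (λ j → *-interchange (a i) (f i σ) (a j) (f j σ))))) ⟩
      𝔼 (λ σ → ∑[ i ∈ is ] ∑[ j ∈ is ] a i * a j * (f i σ * f j σ))
        ≡⟨ 𝔼-∑ is (λ i σ → ∑[ j ∈ is ] a i * a j * (f i σ * f j σ)) ⟩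
      ∑[ i ∈ is ] 𝔼 (λ σ → ∑[ j ∈ is ] a i * a j * (f i σ * f j σ))
        ≡⟨ ∑-cong is (λ i → 𝔼-∑ is (λ j σ → a i * a j * (f i σ * f j σ))) ⟩
      ∑[ i ∈ is ] ∑[ j ∈ is ] 𝔼 (λ σ → a i * a j * (f i σ * f j σ))
        ≡⟨ ∑-cong is (λ i → ∑-cong is (λ j → 𝔼-*ˡ (a i * a j) (λ σ → f i σ * f j σ))) ⟩
      ∑[ i ∈ is ] ∑[ j ∈ is ] a i * a j * M i j ∎
    first-moment² : 𝔼 F * 𝔼 F ≡ ∑[ i ∈ is ] ∑[ j ∈ is ] a i * a j * (μ i * μ j)
    first-moment² = begin
      𝔼 F * 𝔼 F
        ≡⟨ cong (λ m → m * m) (trans (𝔼-∑ is (λ i σ → a i * f i σ)) (∑-cong is (λ i → 𝔼-*ˡ (a i) (f i)))) ⟩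
      (∑[ i ∈ is ] a i * μ i) * (∑[ j ∈ is ] a j * μ j)
        ≡⟨ ∑-*-∑ is is _ _ ⟩
      ∑[ i ∈ is ] ∑[ j ∈ is ] a i * μ i * (a j * μ j)
        ≡⟨ ∑-cong is (λ i → ∑-cong is (λ j → *-interchange (a i) (μ i) (a j) (μ j))) ⟩
      ∑[ i ∈ is ] ∑[ j ∈ is ] a i * a j * (μ i * μ j) ∎

module NearGeometric (N K p : ℚ) (Np≡K : N * p ≡ K) (∣p∣≤1 : ∣ p ∣ ≤ 1ℚ)
                     (R : ℕ → ℚ) (R0≡1 : R 0 ≡ 1ℚ) (∣R∣≤1 : ∀ j → ∣ R j ∣ ≤ 1ℚ)
                     (ratio : ∀ j → R (suc j) * (N - ι j) ≡ R j * (K - ι j)) where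

  deviation : ℕ → ℚ
  deviation j = (R j - p ^ j) * N

  ∣p^j∣≤1 : ∀ j → ∣ p ^ j ∣ ≤ 1ℚ
  ∣p^j∣≤1 zero    = ≤-refl
  ∣p^j∣≤1 (suc j) = ∣*∣-mono-≤ ∣p∣≤1 (∣p^j∣≤1 j)

  deviation-suc : ∀ j → deviation (suc j) ≡ p * deviation j + ι j * (R (suc j) - R j)
  deviation-suc j = begin
    (R (suc j) - p * p ^ j) * N                                ≡⟨ split N (R (suc j)) (ι j) p (p ^ j) ⟩
    R (suc j) * (N - ι j) + ι j * R (suc j) - N * p * p ^ j    ≡⟨ cong (λ r → r + ι j * R (suc j) - N * p * p ^ j) (ratio j) ⟩
    R j * (K - ι j) + ι j * R (suc j) - N * p * p ^ j          ≡⟨ cong (λ k → R j * (k - ι j) + ι j * R (suc j) - N * p * p ^ j) (sym Np≡K) ⟩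
    R j * (N * p - ι j) + ι j * R (suc j) - N * p * p ^ j      ≡⟨ regroup N p (R j) (R (suc j)) (ι j) (p ^ j) ⟩
    p * deviation j + ι j * (R (suc j) - R j)                  ∎
    where
    open ≡-Reasoning
    split : ∀ n r′ i p q → (r′ - p * q) * n ≡ r′ * (n - i) + i * r′ - n * p * q
    split = solve 5 (λ n r′ i p q → (r′ :- p :* q) :* n := r′ :* (n :- i) :+ i :* r′ :- n :* p :* q) refl
    regroup : ∀ n p r r′ i q → r * (n * p - i) + i * r′ - n * p * q ≡ p * ((r - q) * n) + i * (r′ - r)
    regroup = solve 6 (λ n p r r′ i q → r :* (n :* p :- i) :+ i :* r′ :- n :* p :* q := p :* ((r :- q) :* n) :+ i :* (r′ :- r)) refl

  ∣deviation∣≤ : ∀ j → ∣ deviation j ∣ ≤ ι (j ℕ.* j)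
  ∣deviation∣≤ zero    = ≤-reflexive (cong ∣_∣ (trans (cong (λ r → (r - 1ℚ) * N) R0≡1) (*-zeroˡ N)))
  ∣deviation∣≤ (suc j) = begin
    ∣ deviation (suc j) ∣                                 ≡⟨ cong ∣_∣ (deviation-suc j) ⟩
    ∣ p * deviation j + ι j * (R (suc j) - R j) ∣         ≤⟨ ∣p+q∣≤∣p∣+∣q∣ (p * deviation j) (ι j * (R (suc j) - R j)) ⟩
    ∣ p * deviation j ∣ + ∣ ι j * (R (suc j) - R j) ∣     ≤⟨ +-mono-≤ (∣*∣-mono-≤ ∣p∣≤1 (∣deviation∣≤ j))
                                                                      (∣*∣-mono-≤ (≤-reflexive (∣ι∣≡ι j)) (∣p-q∣≤2 (∣R∣≤1 (suc j)) (∣R∣≤1 j))) ⟩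
    1ℚ * ι (j ℕ.* j) + ι j * ι 2                          ≡⟨ cong₂ _+_ (*-identityˡ (ι (j ℕ.* j))) (sym (ι-* j 2)) ⟩
    ι (j ℕ.* j) + ι (j ℕ.* 2)                             ≡⟨ sym (ι-+ (j ℕ.* j) (j ℕ.* 2)) ⟩
    ι (j ℕ.* j ℕ.+ j ℕ.* 2)                               ≤⟨ ι-mono-≤ (subst (j ℕ.* j ℕ.+ j ℕ.* 2 ℕ.≤_) (square-suc j) (ℕₚ.n≤1+n _)) ⟩
    ι (suc j ℕ.* suc j)                                   ∎
    where
    open ≤-Reasoning
    square-suc : ∀ j → suc (j ℕ.* j ℕ.+ j ℕ.* 2) ≡ suc j ℕ.* suc j
    square-suc = solve-∀

  ∣[R[a+b]-RaRb]*N∣≤ : ∀ a b → ∣ (R (a ℕ.+ b) - R a * R b) * N ∣ ≤ ι ((a ℕ.+ b) ℕ.* (a ℕ.+ b) ℕ.+ a ℕ.* a ℕ.+ b ℕ.* b)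
  ∣[R[a+b]-RaRb]*N∣≤ a b = begin
    ∣ (R (a ℕ.+ b) - R a * R b) * N ∣
      ≡⟨ cong ∣_∣ decomposition ⟩
    ∣ deviation (a ℕ.+ b) - deviation a * R b - p ^ a * deviation b ∣
      ≤⟨ ∣p-q∣≤∣p∣+∣q∣ (deviation (a ℕ.+ b) - deviation a * R b) (p ^ a * deviation b) ⟩
    ∣ deviation (a ℕ.+ b) - deviation a * R b ∣ + ∣ p ^ a * deviation b ∣
      ≤⟨ +-monoˡ-≤ ∣ p ^ a * deviation b ∣ (∣p-q∣≤∣p∣+∣q∣ (deviation (a ℕ.+ b)) (deviation a * R b)) ⟩
    ∣ deviation (a ℕ.+ b) ∣ + ∣ deviation a * R b ∣ + ∣ p ^ a * deviation b ∣
      ≤⟨ +-mono-≤ (+-mono-≤ (∣deviation∣≤ (a ℕ.+ b)) (∣*∣-mono-≤ (∣deviation∣≤ a) (∣R∣≤1 b)))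
                  (∣*∣-mono-≤ (∣p^j∣≤1 a) (∣deviation∣≤ b)) ⟩
    ι ((a ℕ.+ b) ℕ.* (a ℕ.+ b)) + ι (a ℕ.* a) * 1ℚ + 1ℚ * ι (b ℕ.* b)
      ≡⟨ cong₂ (λ x y → ι ((a ℕ.+ b) ℕ.* (a ℕ.+ b)) + x + y) (*-identityʳ (ι (a ℕ.* a))) (*-identityˡ (ι (b ℕ.* b))) ⟩
    ι ((a ℕ.+ b) ℕ.* (a ℕ.+ b)) + ι (a ℕ.* a) + ι (b ℕ.* b)
      ≡⟨ sym (trans (ι-+ ((a ℕ.+ b) ℕ.* (a ℕ.+ b) ℕ.+ a ℕ.* a) (b ℕ.* b))
                    (cong (_+ ι (b ℕ.* b)) (ι-+ ((a ℕ.+ b) ℕ.* (a ℕ.+ b)) (a ℕ.* a)))) ⟩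
    ι ((a ℕ.+ b) ℕ.* (a ℕ.+ b) ℕ.+ a ℕ.* a ℕ.+ b ℕ.* b) ∎
    where
    open ≤-Reasoning
    identity : ∀ n r ra rb pa pb → (r - ra * rb) * n ≡ (r - pa * pb) * n - (ra - pa) * n * rb - pa * ((rb - pb) * n)
    identity = solve 6 (λ n r ra rb pa pb → (r :- ra :* rb) :* n := (r :- pa :* pb) :* n :- (ra :- pa) :* n :* rb :- pa :* ((rb :- pb) :* n)) refl
    decomposition : (R (a ℕ.+ b) - R a * R b) * N ≡ deviation (a ℕ.+ b) - deviation a * R b - p ^ a * deviation b
    decomposition = trans (identity N (R (a ℕ.+ b)) (R a) (R b) (p ^ a) (p ^ b))
      (cong (λ z → (R (a ℕ.+ b) - z) * N - deviation a * R b - p ^ a * deviation b) (sym (^-homo-* p a b)))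

nCk*[n+1]≡[n+1]C[k+1]*[k+1] : ∀ n k → (n C k) ℕ.* suc n ≡ (suc n C suc k) ℕ.* suc k
nCk*[n+1]≡[n+1]C[k+1]*[k+1] zero    zero    = refl
nCk*[n+1]≡[n+1]C[k+1]*[k+1] zero    (suc k) = refl
nCk*[n+1]≡[n+1]C[k+1]*[k+1] (suc n) zero    = begin
  1 ℕ.* suc (suc n)            ≡⟨ ℕₚ.*-identityˡ (suc (suc n)) ⟩
  suc (suc n)                  ≡⟨ sym (nC1≡n (suc (suc n))) ⟩
  suc (suc n) C 1              ≡⟨ sym (ℕₚ.*-identityʳ (suc (suc n) C 1)) ⟩
  (suc (suc n) C 1) ℕ.* 1      ∎
  where open ≡-Reasoning
nCk*[n+1]≡[n+1]C[k+1]*[k+1] (suc n) (suc k) = begin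
  (suc n C suc k) ℕ.* (2 ℕ.+ n)
    ≡⟨ cong (ℕ._* (2 ℕ.+ n)) (sym (nCk+nC[k+1]≡[n+1]C[k+1] n k)) ⟩
  (y ℕ.+ x) ℕ.* (2 ℕ.+ n)
    ≡⟨ expand y x n ⟩
  y ℕ.* suc n ℕ.+ x ℕ.* suc n ℕ.+ (y ℕ.+ x)
    ≡⟨ cong₂ (λ u v → u ℕ.+ v ℕ.+ (y ℕ.+ x)) (nCk*[n+1]≡[n+1]C[k+1]*[k+1] n k) (nCk*[n+1]≡[n+1]C[k+1]*[k+1] n (suc k)) ⟩
  (suc n C suc k) ℕ.* suc k ℕ.+ (suc n C (2 ℕ.+ k)) ℕ.* (2 ℕ.+ k) ℕ.+ (y ℕ.+ x)
    ≡⟨ cong₂ (λ u v → u ℕ.* suc k ℕ.+ v ℕ.* (2 ℕ.+ k) ℕ.+ (y ℕ.+ x))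
             (sym (nCk+nC[k+1]≡[n+1]C[k+1] n k)) (sym (nCk+nC[k+1]≡[n+1]C[k+1] n (suc k))) ⟩
  (y ℕ.+ x) ℕ.* suc k ℕ.+ (x ℕ.+ z) ℕ.* (2 ℕ.+ k) ℕ.+ (y ℕ.+ x)
    ≡⟨ collect y x z k ⟩
  (y ℕ.+ x ℕ.+ (x ℕ.+ z)) ℕ.* (2 ℕ.+ k)
    ≡⟨ cong (ℕ._* (2 ℕ.+ k)) (trans (cong₂ ℕ._+_ (nCk+nC[k+1]≡[n+1]C[k+1] n k) (nCk+nC[k+1]≡[n+1]C[k+1] n (suc k)))
                                     (nCk+nC[k+1]≡[n+1]C[k+1] (suc n) (suc k))) ⟩
  (suc (suc n) C suc (suc k)) ℕ.* (2 ℕ.+ k) ∎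
  where
  open ≡-Reasoning
  x = n C suc k
  y = n C k
  z = n C suc (suc k)
  expand : ∀ y x n → (y ℕ.+ x) ℕ.* (2 ℕ.+ n) ≡ y ℕ.* suc n ℕ.+ x ℕ.* suc n ℕ.+ (y ℕ.+ x)
  expand = solve-∀
  collect : ∀ y x z k → (y ℕ.+ x) ℕ.* suc k ℕ.+ (x ℕ.+ z) ℕ.* (2 ℕ.+ k) ℕ.+ (y ℕ.+ x) ≡ (y ℕ.+ x ℕ.+ (x ℕ.+ z)) ℕ.* (2 ℕ.+ k)
  collect = solve-∀

-- supersets n k j counts the k-subsets of an n-set containing a fixed j-subset, i.e. C(n-j, k-j).
supersets : ℕ → ℕ → ℕ → ℕ
supersets n       k       zero    = n C k
supersets zero    k       (suc j) = 0
supersets (suc n) zero    (suc j) = 0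
supersets (suc n) (suc k) (suc j) = supersets n k j

supersets-suc-zero : ∀ n j → supersets (suc n) 0 j ≡ supersets n 0 j
supersets-suc-zero n       zero    = refl
supersets-suc-zero zero    (suc j) = refl
supersets-suc-zero (suc n) (suc j) = refl

supersets-pascal : ∀ {n} k j → j ℕ.≤ n → supersets (suc n) (suc k) j ≡ supersets n (suc k) j ℕ.+ supersets n k j
supersets-pascal {n}     k       zero    _         =
  trans (sym (nCk+nC[k+1]≡[n+1]C[k+1] n k)) (ℕₚ.+-comm (n C k) (n C suc k))
supersets-pascal {suc n} zero    (suc j) (s≤s j≤n) =
  trans (supersets-suc-zero n j) (sym (ℕₚ.+-identityʳ (supersets n 0 j)))
supersets-pascal {suc n} (suc k) (suc j) (s≤s j≤n) = supersets-pascal k j j≤n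

supersets≤nCk : ∀ n k j → supersets n k j ℕ.≤ n C k
supersets≤nCk n       k       zero    = ℕₚ.≤-refl
supersets≤nCk zero    k       (suc j) = z≤n
supersets≤nCk (suc n) zero    (suc j) = z≤n
supersets≤nCk (suc n) (suc k) (suc j) = ℕₚ.≤-trans (supersets≤nCk n k j)
  (subst (n C k ℕ.≤_) (nCk+nC[k+1]≡[n+1]C[k+1] n k) (ℕₚ.m≤m+n (n C k) (n C suc k)))

supersets-vanish : ∀ n {k j} → k ℕ.< j → supersets n k j ≡ 0
supersets-vanish zero    {k}     {suc j} _         = refl
supersets-vanish (suc n) {zero}  {suc j} _         = refl
supersets-vanish (suc n) {suc k} {suc j} (s≤s k<j) = supersets-vanish n k<j

supersets-ratio : ∀ n k j → supersets n k (suc j) ℕ.* (n ℕ.∸ j) ≡ supersets n k j ℕ.* (k ℕ.∸ j)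
supersets-ratio zero    zero    zero    = refl
supersets-ratio zero    (suc k) zero    = refl
supersets-ratio (suc n) zero    zero    = refl
supersets-ratio (suc n) (suc k) zero    = nCk*[n+1]≡[n+1]C[k+1]*[k+1] n k
supersets-ratio zero    k       (suc j) = refl
supersets-ratio (suc n) zero    (suc j) = refl
supersets-ratio (suc n) (suc k) (suc j) = supersets-ratio n k j

ι-supersets-ratio : ∀ {n k} j → k ℕ.≤ n →
  ι (supersets n k (suc j)) * (ι n - ι j) ≡ ι (supersets n k j) * (ι k - ι j)
ι-supersets-ratio {n} {k} j k≤n with j ℕ.≤? k
... | yes j≤k = begin
  ι (supersets n k (suc j)) * (ι n - ι j)     ≡⟨ cong (ι (supersets n k (suc j)) *_) (sym (ι-∸ (ℕₚ.≤-trans j≤k k≤n))) ⟩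
  ι (supersets n k (suc j)) * ι (n ℕ.∸ j)     ≡⟨ sym (ι-* (supersets n k (suc j)) (n ℕ.∸ j)) ⟩
  ι (supersets n k (suc j) ℕ.* (n ℕ.∸ j))     ≡⟨ cong ι (supersets-ratio n k j) ⟩
  ι (supersets n k j ℕ.* (k ℕ.∸ j))           ≡⟨ ι-* (supersets n k j) (k ℕ.∸ j) ⟩
  ι (supersets n k j) * ι (k ℕ.∸ j)           ≡⟨ cong (ι (supersets n k j) *_) (ι-∸ j≤k) ⟩
  ι (supersets n k j) * (ι k - ι j)           ∎
  where open ≡-Reasoning
... | no j≰k = begin
  ι (supersets n k (suc j)) * (ι n - ι j)     ≡⟨ cong (λ m → ι m * (ι n - ι j)) (supersets-vanish n (ℕₚ.m<n⇒m<1+n k<j)) ⟩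
  0ℚ * (ι n - ι j)                            ≡⟨ *-zeroˡ (ι n - ι j) ⟩
  0ℚ                                          ≡⟨ sym (*-zeroˡ (ι k - ι j)) ⟩
  0ℚ * (ι k - ι j)                            ≡⟨ cong (λ m → ι m * (ι k - ι j)) (sym (supersets-vanish n k<j)) ⟩
  ι (supersets n k j) * (ι k - ι j)           ∎
  where
  open ≡-Reasoning
  k<j = ℕₚ.≰⇒> j≰k

module _ {A B : Set} {P : B → Set} (P? : Decidable P) (g : A → B) where

  filter-map : ∀ {Q : A → Set} (Q? : Decidable Q) → (∀ x → does (P? (g x)) ≡ does (Q? x)) →
               ∀ xs → filter P? (map g xs) ≡ map g (filter Q? xs)
  filter-map Q? agree []       = refl
  filter-map Q? agree (x ∷ xs) with does (P? (g x)) | does (Q? x) | agree x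
  ... | true  | .true  | refl = cong (g x ∷_) (filter-map Q? agree xs)
  ... | false | .false | refl = filter-map Q? agree xs

  filter-map-reject : (∀ x → does (P? (g x)) ≡ false) → ∀ xs → filter P? (map g xs) ≡ []
  filter-map-reject reject []       = refl
  filter-map-reject reject (x ∷ xs) with does (P? (g x)) | reject x
  ... | false | refl = filter-map-reject reject xs

Slice-suc : ∀ n k → Slice (suc n) (suc k) ≡ map (false ∷_) (Slice n (suc k)) ++ map (true ∷_) (Slice n k)
Slice-suc n k = trans (List.filter-++ _ (map (false ∷_) (cube n)) (map (true ∷_) (cube n)))
  (cong₂ _++_ (filter-map _ (false ∷_) _ (λ _ → refl) (cube n)) (filter-map _ (true ∷_) _ (λ _ → refl) (cube n)))

Slice-suc-zero : ∀ n → Slice (suc n) zero ≡ map (false ∷_) (Slice n zero) ++ []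
Slice-suc-zero n = trans (List.filter-++ _ (map (false ∷_) (cube n)) (map (true ∷_) (cube n)))
  (cong₂ _++_ (filter-map _ (false ∷_) _ (λ _ → refl) (cube n)) (filter-map-reject _ (true ∷_) (λ _ → refl) (cube n)))

∑-Slice-suc : ∀ n k (f : Vec Bool (suc n) → ℚ) →
  ∑ (Slice (suc n) (suc k)) f ≡ (∑[ σ ∈ Slice n (suc k) ] f (false ∷ σ)) + (∑[ σ ∈ Slice n k ] f (true ∷ σ))
∑-Slice-suc n k f = begin
  ∑ (Slice (suc n) (suc k)) f
    ≡⟨ cong (λ L → ∑ L f) (Slice-suc n k) ⟩
  ∑ (map (false ∷_) (Slice n (suc k)) ++ map (true ∷_) (Slice n k)) f
    ≡⟨ ∑-++ (map (false ∷_) (Slice n (suc k))) (map (true ∷_) (Slice n k)) f ⟩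
  ∑ (map (false ∷_) (Slice n (suc k))) f + ∑ (map (true ∷_) (Slice n k)) f
    ≡⟨ cong₂ _+_ (∑-map (false ∷_) (Slice n (suc k)) f) (∑-map (true ∷_) (Slice n k) f) ⟩
  (∑[ σ ∈ Slice n (suc k) ] f (false ∷ σ)) + (∑[ σ ∈ Slice n k ] f (true ∷ σ)) ∎
  where open ≡-Reasoning

∑-Slice-suc-zero : ∀ n (f : Vec Bool (suc n) → ℚ) → ∑ (Slice (suc n) zero) f ≡ ∑[ σ ∈ Slice n zero ] f (false ∷ σ)
∑-Slice-suc-zero n f = begin
  ∑ (Slice (suc n) zero) f                          ≡⟨ cong (λ L → ∑ L f) (Slice-suc-zero n) ⟩
  ∑ (map (false ∷_) (Slice n zero) ++ []) f          ≡⟨ ∑-++ (map (false ∷_) (Slice n zero)) [] f ⟩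
  ∑ (map (false ∷_) (Slice n zero)) f + 0ℚ           ≡⟨ +-identityʳ _ ⟩
  ∑ (map (false ∷_) (Slice n zero)) f                ≡⟨ ∑-map (false ∷_) (Slice n zero) f ⟩
  ∑[ σ ∈ Slice n zero ] f (false ∷ σ)                ∎
  where open ≡-Reasoning

∑-Slice-monomial : ∀ n k (S : Vec Bool n) → ∑[ σ ∈ Slice n k ] monomial S σ ≡ ι (supersets n k (weight S))
∑-Slice-scaled-monomial : ∀ n k (S : Vec Bool n) c →
  ∑[ σ ∈ Slice n k ] c * monomial S σ ≡ c * ι (supersets n k (weight S))

∑-Slice-scaled-monomial n k S c =
  trans (sym (*-distribˡ-∑ c (Slice n k) (monomial S))) (cong (_*_ c) (∑-Slice-monomial n k S))

∑-Slice-monomial zero    zero    []          = refl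
∑-Slice-monomial zero    (suc k) []          = refl
∑-Slice-monomial (suc n) zero    (false ∷ S) = begin
  ∑[ σ ∈ Slice (suc n) 0 ] monomial (false ∷ S) σ    ≡⟨ ∑-Slice-suc-zero n (monomial (false ∷ S)) ⟩
  ∑[ σ ∈ Slice n 0 ] 1ℚ * monomial S σ               ≡⟨ ∑-Slice-scaled-monomial n 0 S 1ℚ ⟩
  1ℚ * ι (supersets n 0 (weight S))                  ≡⟨ *-identityˡ (ι (supersets n 0 (weight S))) ⟩
  ι (supersets n 0 (weight S))                       ≡⟨ cong ι (sym (supersets-suc-zero n (weight S))) ⟩
  ι (supersets (suc n) 0 (weight S))                 ∎
  where open ≡-Reasoning
∑-Slice-monomial (suc n) zero    (true ∷ S)  = begin
  ∑[ σ ∈ Slice (suc n) 0 ] monomial (true ∷ S) σ     ≡⟨ ∑-Slice-suc-zero n (monomial (true ∷ S)) ⟩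
  ∑[ σ ∈ Slice n 0 ] 0ℚ * monomial S σ               ≡⟨ ∑-Slice-scaled-monomial n 0 S 0ℚ ⟩
  0ℚ * ι (supersets n 0 (weight S))                  ≡⟨ *-zeroˡ (ι (supersets n 0 (weight S))) ⟩
  0ℚ                                                 ∎
  where open ≡-Reasoning
∑-Slice-monomial (suc n) (suc k) (false ∷ S) = begin
  ∑[ σ ∈ Slice (suc n) (suc k) ] monomial (false ∷ S) σ
    ≡⟨ ∑-Slice-suc n k (monomial (false ∷ S)) ⟩
  (∑[ σ ∈ Slice n (suc k) ] 1ℚ * monomial S σ) + (∑[ σ ∈ Slice n k ] 1ℚ * monomial S σ)
    ≡⟨ cong₂ _+_ (trans (∑-Slice-scaled-monomial n (suc k) S 1ℚ) (*-identityˡ (ι (supersets n (suc k) (weight S)))))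
                 (trans (∑-Slice-scaled-monomial n k S 1ℚ) (*-identityˡ (ι (supersets n k (weight S))))) ⟩
  ι (supersets n (suc k) (weight S)) + ι (supersets n k (weight S))
    ≡⟨ sym (ι-+ (supersets n (suc k) (weight S)) (supersets n k (weight S))) ⟩
  ι (supersets n (suc k) (weight S) ℕ.+ supersets n k (weight S))
    ≡⟨ cong ι (sym (supersets-pascal k (weight S) (weight≤length S))) ⟩
  ι (supersets (suc n) (suc k) (weight S)) ∎
  where open ≡-Reasoning
∑-Slice-monomial (suc n) (suc k) (true ∷ S)  = begin
  ∑[ σ ∈ Slice (suc n) (suc k) ] monomial (true ∷ S) σ
    ≡⟨ ∑-Slice-suc n k (monomial (true ∷ S)) ⟩
  (∑[ σ ∈ Slice n (suc k) ] 0ℚ * monomial S σ) + (∑[ σ ∈ Slice n k ] 1ℚ * monomial S σ)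
    ≡⟨ cong₂ _+_ (trans (∑-Slice-scaled-monomial n (suc k) S 0ℚ) (*-zeroˡ (ι (supersets n (suc k) (weight S)))))
                 (trans (∑-Slice-scaled-monomial n k S 1ℚ) (*-identityˡ (ι (supersets n k (weight S))))) ⟩
  0ℚ + ι (supersets n k (weight S))
    ≡⟨ +-identityˡ (ι (supersets n k (weight S))) ⟩
  ι (supersets n k (weight S)) ∎
  where open ≡-Reasoning

monomial-∅ : ∀ {n} (σ : Vec Bool n) → monomial (∅ n) σ ≡ 1ℚ
monomial-∅ []      = refl
monomial-∅ (b ∷ σ) = trans (*-identityˡ (monomial (∅ _) σ)) (monomial-∅ σ)

monomial-∪ : ∀ {n} (S T σ : Vec Bool n) → monomial S σ * monomial T σ ≡ monomial (S ∪ T) σ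
monomial-∪ []      []      []      = refl
monomial-∪ (s ∷ S) (t ∷ T) (b ∷ σ) =
  trans (*-interchange (factor s) (monomial S σ) (factor t) (monomial T σ))
        (cong₂ _*_ (factor-∨ s t) (monomial-∪ S T σ))
  where
  factor : Bool → ℚ
  factor s = if s then bitℚ b else 1ℚ
  bit-idem : ∀ b → bitℚ b * bitℚ b ≡ bitℚ b
  bit-idem true  = refl
  bit-idem false = refl
  factor-∨ : ∀ s t → factor s * factor t ≡ factor (s ∨ t)
  factor-∨ true  true  = bit-idem b
  factor-∨ true  false = *-identityʳ (bitℚ b)
  factor-∨ false true  = *-identityˡ (bitℚ b)
  factor-∨ false false = refl

κ : ℕ → ℕ
κ d = 2 ℕ.+ 6 ℕ.* d ℕ.* d

κ-disjoint : ∀ {a b d} → a ℕ.≤ d → b ℕ.≤ d → (a ℕ.+ b) ℕ.* (a ℕ.+ b) ℕ.+ a ℕ.* a ℕ.+ b ℕ.* b ℕ.≤ κ d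
κ-disjoint {a} {b} {d} a≤d b≤d = begin
  (a ℕ.+ b) ℕ.* (a ℕ.+ b) ℕ.+ a ℕ.* a ℕ.+ b ℕ.* b
    ≤⟨ ℕₚ.+-mono-≤ (ℕₚ.+-mono-≤ (ℕₚ.*-mono-≤ a+b≤d+d a+b≤d+d) (ℕₚ.*-mono-≤ a≤d a≤d)) (ℕₚ.*-mono-≤ b≤d b≤d) ⟩
  (d ℕ.+ d) ℕ.* (d ℕ.+ d) ℕ.+ d ℕ.* d ℕ.+ d ℕ.* d
    ≡⟨ six d ⟩
  6 ℕ.* d ℕ.* d
    ≤⟨ ℕₚ.m≤n+m (6 ℕ.* d ℕ.* d) 2 ⟩
  κ d ∎
  where
  open ℕₚ.≤-Reasoning
  a+b≤d+d = ℕₚ.+-mono-≤ a≤d b≤d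
  six : ∀ d → (d ℕ.+ d) ℕ.* (d ℕ.+ d) ℕ.+ d ℕ.* d ℕ.+ d ℕ.* d ≡ 6 ℕ.* d ℕ.* d
  six = solve-∀

κ-overlapping : ∀ d n w .{{_ : NonZero n}} → 2 ℕ.* n ℕ.≤ κ d ℕ.* n ℕ.^ suc w
κ-overlapping d n w = ℕₚ.*-mono-≤ (ℕₚ.m≤m+n 2 (6 ℕ.* d ℕ.* d)) (ℕₚ.m≤m*n n (n ℕ.^ w) {{ℕₚ.m^n≢0 n w}})

module SliceCovariance (n k : ℕ) .{{_ : NonZero n}} (k≤n : k ℕ.≤ n)
                       (x : Vec Bool n) (xs : List (Vec Bool n))
                       (moments : ∀ S → ∑[ σ ∈ x ∷ xs ] monomial S σ ≡ ι (supersets n k (weight S))) where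

  open Uniform x xs public

  instance
    w-nonNeg : NonNegative w
    w-nonNeg = normalize-nonNeg 1 (suc (length xs))

  R : ℕ → ℚ
  R j = ι (supersets n k j) * w

  𝔼-monomial : ∀ S → 𝔼 (monomial S) ≡ R (weight S)
  𝔼-monomial S = trans (𝔼-≡-∑ (monomial S)) (cong (_* w) (moments S))

  R-zero : R 0 ≡ 1ℚ
  R-zero = begin
    R 0                  ≡⟨ cong R (sym (weight-∅ n)) ⟩
    R (weight (∅ n))     ≡⟨ sym (𝔼-monomial (∅ n)) ⟩
    𝔼 (monomial (∅ n))   ≡⟨ 𝔼-cong monomial-∅ ⟩
    𝔼 (λ _ → 1ℚ)         ≡⟨ 𝔼-const 1ℚ ⟩
    1ℚ                   ∎
    where open ≡-Reasoning

  ∣R∣≤1 : ∀ j → ∣ R j ∣ ≤ 1ℚ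
  ∣R∣≤1 j = 0≤p≤1⇒∣p∣≤1 (*-nonNeg (ι-nonNeg (supersets n k j)) (nonNegative⁻¹ w)) (begin
    R j   ≤⟨ *-monoʳ-≤-nonNeg w (ι-mono-≤ (supersets≤nCk n k j)) ⟩
    R 0   ≡⟨ R-zero ⟩
    1ℚ    ∎)
    where open ≤-Reasoning

  R-ratio : ∀ j → R (suc j) * (ι n - ι j) ≡ R j * (ι k - ι j)
  R-ratio j = begin
    ι (supersets n k (suc j)) * w * (ι n - ι j)   ≡⟨ xy∙z≈xz∙y (ι (supersets n k (suc j))) w (ι n - ι j) ⟩
    ι (supersets n k (suc j)) * (ι n - ι j) * w   ≡⟨ cong (_* w) (ι-supersets-ratio j k≤n) ⟩
    ι (supersets n k j) * (ι k - ι j) * w         ≡⟨ xy∙z≈xz∙y (ι (supersets n k j)) (ι k - ι j) w ⟩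
    ι (supersets n k j) * w * (ι k - ι j)         ∎
    where open ≡-Reasoning

  p : ℚ
  p = ι k * (+ 1 / n)

  ι-n*p≡ι-k : ι n * p ≡ ι k
  ι-n*p≡ι-k = begin
    ι n * (ι k * (+ 1 / n))   ≡⟨ x∙yz≈y∙xz (ι n) (ι k) (+ 1 / n) ⟩
    ι k * (ι n * (+ 1 / n))   ≡⟨ cong (_*_ (ι k)) (ι-*-1/ n) ⟩
    ι k * 1ℚ                  ≡⟨ *-identityʳ (ι k) ⟩
    ι k                       ∎
    where open ≡-Reasoning

  ∣p∣≤1 : ∣ p ∣ ≤ 1ℚ
  ∣p∣≤1 = 0≤p≤1⇒∣p∣≤1 (*-nonNeg (ι-nonNeg k) (nonNegative⁻¹ _ {{1/n-nonNeg}})) (begin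
    ι k * (+ 1 / n)   ≤⟨ *-monoʳ-≤-nonNeg (+ 1 / n) {{1/n-nonNeg}} (ι-mono-≤ k≤n) ⟩
    ι n * (+ 1 / n)   ≡⟨ ι-*-1/ n ⟩
    1ℚ                ∎)
    where
    open ≤-Reasoning
    1/n-nonNeg = normalize-nonNeg 1 n

  open NearGeometric (ι n) (ι k) p ι-n*p≡ι-k ∣p∣≤1 R R-zero ∣R∣≤1 R-ratio

  R-covariance-bound : ∀ d (S T : Vec Bool n) → weight S ℕ.≤ d → weight T ℕ.≤ d →
    ∣ (R (weight (S ∪ T)) - R (weight S) * R (weight T)) * ι n ∣ ≤ ι (κ d) * ι (n ℕ.^ weight (S ∩ T))
  R-covariance-bound d S T |S|≤d |T|≤d with weight (S ∩ T) | weight-∪+weight-∩ S T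
  ... | zero  | |S∪T|+0≡|S|+|T| = begin
    ∣ (R (weight (S ∪ T)) - R (weight S) * R (weight T)) * ι n ∣
      ≡⟨ cong (λ u → ∣ (R u - R (weight S) * R (weight T)) * ι n ∣)
              (trans (sym (ℕₚ.+-identityʳ (weight (S ∪ T)))) |S∪T|+0≡|S|+|T|) ⟩
    ∣ (R (weight S ℕ.+ weight T) - R (weight S) * R (weight T)) * ι n ∣
      ≤⟨ ∣[R[a+b]-RaRb]*N∣≤ (weight S) (weight T) ⟩
    ι ((weight S ℕ.+ weight T) ℕ.* (weight S ℕ.+ weight T) ℕ.+ weight S ℕ.* weight S ℕ.+ weight T ℕ.* weight T)
      ≤⟨ ι-mono-≤ (κ-disjoint |S|≤d |T|≤d) ⟩
    ι (κ d)
      ≡⟨ sym (*-identityʳ (ι (κ d))) ⟩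
    ι (κ d) * ι (n ℕ.^ 0) ∎
    where open ≤-Reasoning
  ... | suc m | _ = begin
    ∣ (R (weight (S ∪ T)) - R (weight S) * R (weight T)) * ι n ∣
      ≤⟨ ∣*∣-mono-≤ (∣p-q∣≤2 (∣R∣≤1 (weight (S ∪ T))) (∣*∣-mono-≤ (∣R∣≤1 (weight S)) (∣R∣≤1 (weight T))))
                    (≤-reflexive (∣ι∣≡ι n)) ⟩
    ι 2 * ι n                       ≡⟨ sym (ι-* 2 n) ⟩
    ι (2 ℕ.* n)                     ≤⟨ ι-mono-≤ (κ-overlapping d n m) ⟩
    ι (κ d ℕ.* n ℕ.^ suc m)         ≡⟨ ι-* (κ d) (n ℕ.^ suc m) ⟩
    ι (κ d) * ι (n ℕ.^ suc m)       ∎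
    where open ≤-Reasoning

  covariance-bound : ∀ d (S T : Vec Bool n) → weight S ℕ.≤ d → weight T ℕ.≤ d →
    ∣ (𝔼 (λ σ → monomial S σ * monomial T σ) - 𝔼 (monomial S) * 𝔼 (monomial T)) * ι n ∣
      ≤ ι (κ d) * ι (n ℕ.^ weight (S ∩ T))
  covariance-bound d S T |S|≤d |T|≤d = subst (_≤ ι (κ d) * ι (n ℕ.^ weight (S ∩ T)))
    (cong (λ c → ∣ c * ι n ∣) (sym (cong₂ _-_ (trans (𝔼-cong (monomial-∪ S T)) (𝔼-monomial (S ∪ T)))
                                               (cong₂ _*_ (𝔼-monomial S) (𝔼-monomial T)))))
    (R-covariance-bound d S T |S|≤d |T|≤d)

varianceConstant : ℕ → ℚ → ℚ
varianceConstant d q = q * q * ι (κ d) * ι (4 ℕ.^ (2 ℕ.* d))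

module SliceVariance {n k d : ℕ} {q : ℚ} .{{_ : NonZero n}} (k≤n : k ℕ.≤ n) (0≤q : 0ℚ ≤ q)
                     (c : Multilinear n) (deg : DegreeAtMost d c) (∣c∣≤q : ∀ S → ∣ c S ∣ ≤ q)
                     (x : Vec Bool n) (xs : List (Vec Bool n))
                     (moments : ∀ S → ∑[ σ ∈ x ∷ xs ] monomial S σ ≡ ι (supersets n k (weight S))) where

  open SliceCovariance n k k≤n x xs moments using (𝔼; variance-∑; covariance-bound)
  open OverlapCount n using (pairWeight; overlapSum; overlapSum-diagonal)

  Q : ℚ
  Q = q * q * ι (κ d)

  0≤Q : 0ℚ ≤ Q
  0≤Q = *-nonNeg (*-nonNeg 0≤q 0≤q) (ι-nonNeg (κ d))

  Cov : Vec Bool n → Vec Bool n → ℚ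
  Cov S T = 𝔼 (λ σ → monomial S σ * monomial T σ) - 𝔼 (monomial S) * 𝔼 (monomial T)

  term-bound : ∀ S T → c S * c T * Cov S T * ι n ≤ Q * ι (pairWeight d d S T)
  term-bound S T with weight S ℕ.≤? d | weight T ℕ.≤? d
  ... | no |S|≰d | _ = ≤-trans
    (≤-reflexive (trans (cong (λ a → a * c T * Cov S T * ι n) (deg S (ℕₚ.≰⇒> |S|≰d))) (annihilateˡ (c T) (Cov S T) (ι n))))
    (*-nonNeg 0≤Q (ι-nonNeg (pairWeight d d S T)))
    where
    annihilateˡ : ∀ a b c → 0ℚ * a * b * c ≡ 0ℚ
    annihilateˡ = solve 3 (λ a b c → con 0ℚ :* a :* b :* c := con 0ℚ) refl
  ... | yes _ | no |T|≰d = ≤-trans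
    (≤-reflexive (trans (cong (λ b → c S * b * Cov S T * ι n) (deg T (ℕₚ.≰⇒> |T|≰d))) (annihilateʳ (c S) (Cov S T) (ι n))))
    (*-nonNeg 0≤Q (ι-nonNeg (pairWeight d d S T)))
    where
    annihilateʳ : ∀ a b c → a * 0ℚ * b * c ≡ 0ℚ
    annihilateʳ = solve 3 (λ a b c → a :* con 0ℚ :* b :* c := con 0ℚ) refl
  ... | yes |S|≤d | yes |T|≤d = begin
    c S * c T * Cov S T * ι n                      ≡⟨ *-assoc (c S * c T) (Cov S T) (ι n) ⟩
    c S * c T * (Cov S T * ι n)                    ≤⟨ p≤∣p∣ (c S * c T * (Cov S T * ι n)) ⟩
    ∣ c S * c T * (Cov S T * ι n) ∣                ≤⟨ ∣*∣-mono-≤ (∣*∣-mono-≤ (∣c∣≤q S) (∣c∣≤q T))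
                                                                 (covariance-bound d S T |S|≤d |T|≤d) ⟩
    q * q * (ι (κ d) * ι (n ℕ.^ weight (S ∩ T)))   ≡⟨ sym (*-assoc (q * q) (ι (κ d)) _) ⟩
    Q * ι (n ℕ.^ weight (S ∩ T))                   ≡⟨ cong (λ m → Q * ι m) (sym indicators) ⟩
    Q * ι (pairWeight d d S T)                     ∎
    where
    open ≤-Reasoning
    indicators : pairWeight d d S T ≡ n ℕ.^ weight (S ∩ T)
    indicators = trans (cong₂ (λ a b → a ℕ.* b ℕ.* n ℕ.^ weight (S ∩ T)) (atMost-≤ S |S|≤d) (atMost-≤ T |T|≤d))
                       (ℕₚ.*-identityˡ (n ℕ.^ weight (S ∩ T)))

  ∑∑-Q*ι : ∑[ S ∈ cube n ] ∑[ T ∈ cube n ] Q * ι (pairWeight d d S T) ≡ Q * ι (overlapSum n d d)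
  ∑∑-Q*ι = sym (begin
    Q * ι (overlapSum n d d)
      ≡⟨ cong (_*_ Q) (ι-∑ (cube n) (λ S → ℕΣ.∑ (cube n) (pairWeight d d S))) ⟩
    Q * (∑[ S ∈ cube n ] ι (ℕΣ.∑ (cube n) (pairWeight d d S)))
      ≡⟨ *-distribˡ-∑ Q (cube n) _ ⟩
    ∑[ S ∈ cube n ] Q * ι (ℕΣ.∑ (cube n) (pairWeight d d S))
      ≡⟨ ∑-cong (cube n) (λ S → trans (cong (_*_ Q) (ι-∑ (cube n) (pairWeight d d S))) (*-distribˡ-∑ Q (cube n) _)) ⟩
    ∑[ S ∈ cube n ] ∑[ T ∈ cube n ] Q * ι (pairWeight d d S T) ∎)
    where open ≡-Reasoning

  variance-bound : variance (x ∷ xs) (eval c) * ι n ≤ varianceConstant d q * ι (n ℕ.^ (2 ℕ.* d))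
  variance-bound = begin
    variance (x ∷ xs) (eval c) * ι n
      ≡⟨ cong (_* ι n) (variance-∑ (cube n) c monomial) ⟩
    (∑[ S ∈ cube n ] ∑[ T ∈ cube n ] c S * c T * Cov S T) * ι n
      ≡⟨ trans (*-distribʳ-∑ (ι n) (cube n) _) (∑-cong (cube n) (λ S → *-distribʳ-∑ (ι n) (cube n) _)) ⟩
    ∑[ S ∈ cube n ] ∑[ T ∈ cube n ] c S * c T * Cov S T * ι n
      ≤⟨ ∑-mono-≤ (cube n) (λ S → ∑-mono-≤ (cube n) (λ T → term-bound S T)) ⟩
    ∑[ S ∈ cube n ] ∑[ T ∈ cube n ] Q * ι (pairWeight d d S T)
      ≡⟨ ∑∑-Q*ι ⟩
    Q * ι (overlapSum n d d)
      ≤⟨ *-monoˡ-≤-nonNeg Q {{nonNegative 0≤Q}} (ι-mono-≤ (overlapSum-diagonal d)) ⟩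
    Q * ι (4 ℕ.^ (2 ℕ.* d) ℕ.* n ℕ.^ (2 ℕ.* d))
      ≡⟨ trans (cong (_*_ Q) (ι-* (4 ℕ.^ (2 ℕ.* d)) (n ℕ.^ (2 ℕ.* d)))) (sym (*-assoc Q _ _)) ⟩
    varianceConstant d q * ι (n ℕ.^ (2 ℕ.* d)) ∎
    where open ≤-Reasoning

variance-Slice-bound : ∀ {n k d q} .{{_ : NonZero n}} → k ℕ.≤ n → 0ℚ ≤ q →
  (c : Multilinear n) → DegreeAtMost d c → (∀ S → ∣ c S ∣ ≤ q) →
  variance (Slice n k) (eval c) * ι n ≤ varianceConstant d q * ι (n ℕ.^ (2 ℕ.* d))
variance-Slice-bound {n} {k} {d} {q} k≤n 0≤q c deg ∣c∣≤q with Slice n k | ∑-Slice-monomial n k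
... | []     | _       = ≤-trans (≤-reflexive (*-zeroˡ (ι n)))
  (*-nonNeg (*-nonNeg (*-nonNeg (*-nonNeg 0≤q 0≤q) (ι-nonNeg (κ d))) (ι-nonNeg (4 ℕ.^ (2 ℕ.* d)))) (ι-nonNeg (n ℕ.^ (2 ℕ.* d))))
... | x ∷ xs | moments = SliceVariance.variance-bound k≤n 0≤q c deg ∣c∣≤q x xs moments

proposition9p1 : (d : ℕ) (q : ℚ) → 0ℚ < q →
    Σ ℚ λ C → ∀ (n k : ℕ) → 1 ℕ.≤ k → k ℕ.≤ n →
      (c : Multilinear n) → DegreeAtMost d c → (∀ S → ∣ c S ∣ ≤ q) →
        variance (Slice n k) (eval c) * (+ n / 1) ≤ C * (+ (n ℕ.^ (2 ℕ.* d)) / 1)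
proposition9p1 d q 0<q = varianceConstant d q , λ n k 1≤k k≤n c deg ∣c∣≤q →
  variance-Slice-bound {{ℕ.>-nonZero (ℕₚ.≤-trans 1≤k k≤n)}} k≤n (<⇒≤ 0<q) c deg ∣c∣≤q
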